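{- Let $S$ be a 2D string and let $t$, $b$ be its top and bottom rows and $\ell$, $r$ its left and right columns (each viewed as an ordinary string). Let $\mathcal{G}$ be a 2D SLP deriving $S$. Then there are 1D SLPs deriving $t$, $b$, $\ell$, and $r$, respectively, each of size at most $|\mathcal{G}|$.
   Context: $\Sigma$ is a finite alphabet; a 2D string is a rectangular array over $\Sigma$. A 2D SLP consists of a finite set of nonterminals, a starting nonterminal, and for each nonterminal $X$ one production whose right-hand side is either a character $\sigma\in\Sigma$, or a horizontal concatenation $\mathrm{hcat}(Y,Z)$ of two nonterminals deriving strings of equal height, or a vertical concatenation $\mathrm{vcat}(Y,Z)$ of two nonterminals deriving strings of equal width, with the relation "$Y$ occurs in the right-hand side of $X$" acyclic; it derives the string of its starting nonterminal. A 1D SLP is such a grammar using only concatenations in one direction, deriving a single ordinary string. The size is the total number of symbols on the right-hand sides of all productions. -}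

module Defs where

open import Data.Nat using (ℕ; zero; suc; _+_; _≤_)
open import Data.Fin using (Fin)
import Data.Fin as F
open import Data.List using (List; []; _∷_; _++_)
open import Data.Vec using (Vec; head; last; toList; zipWith)
import Data.Vec as V
open import Data.Product using (Σ; _×_)
open import Induction.WellFounded using (WellFounded)
open import Relation.Binary.PropositionalEquality using (_≡_)

record Str2 (A : Set) : Set where
  constructor mk2
  field
    h     : ℕ
    w     : ℕ
    cells : Vec (Vec A w) h
open Str2 public

-- top / bottom rows, left / right columns as ordinary strings
-- (for degenerate strings with no rows/columns we return []; derived
--  strings are never degenerate).
topRow : ∀ {A} → Str2 A → List A
topRow (mk2 zero w c) = []
topRow (mk2 (suc h) w c) = toList (head c)

bottomRow : ∀ {A} → Str2 A → List A
bottomRow (mk2 zero w c) = []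
bottomRow (mk2 (suc h) w c) = toList (last c)

leftCol : ∀ {A} → Str2 A → List A
leftCol (mk2 h zero c) = []
leftCol (mk2 h (suc w) c) = toList (V.map head c)

rightCol : ∀ {A} → Str2 A → List A
rightCol (mk2 h zero c) = []
rightCol (mk2 h (suc w) c) = toList (V.map last c)

data Rule2 (k n : ℕ) : Set where
  char : Fin k → Rule2 k n
  hcat : Fin n → Fin n → Rule2 k n
  vcat : Fin n → Fin n → Rule2 k n

data Occurs2 {k n : ℕ} (rule : Fin n → Rule2 k n) : Fin n → Fin n → Set where
  hcat-l : ∀ {X Y Z} → rule X ≡ hcat Y Z → Occurs2 rule Y X
  hcat-r : ∀ {X Y Z} → rule X ≡ hcat Y Z → Occurs2 rule Z X
  vcat-l : ∀ {X Y Z} → rule X ≡ vcat Y Z → Occurs2 rule Y X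
  vcat-r : ∀ {X Y Z} → rule X ≡ vcat Y Z → Occurs2 rule Z X

record SLP2 (k : ℕ) : Set where
  field
    n       : ℕ
    start   : Fin n
    rule    : Fin n → Rule2 k n
    acyclic : WellFounded (Occurs2 rule)
open SLP2 public

rsize2 : ∀ {k n} → Rule2 k n → ℕ
rsize2 (char _) = 1
rsize2 (hcat _ _) = 2
rsize2 (vcat _ _) = 2

sumFin : ∀ {n} → (Fin n → ℕ) → ℕ
sumFin {zero} f = 0
sumFin {suc n} f = f F.zero + sumFin (λ i → f (F.suc i))


size2 : ∀ {k} → SLP2 k → ℕ
size2 G = sumFin (λ X → rsize2 (rule G X))

data Derives2 {k : ℕ} (G : SLP2 k) : Fin (n G) → Str2 (Fin k) → Set where
  d-char : ∀ {X a} → rule G X ≡ char a →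
           Derives2 G X (mk2 1 1 ((a V.∷ V.[]) V.∷ V.[]))
  d-hcat : ∀ {X Y Z ht w₁ w₂} {c₁ : Vec (Vec (Fin k) w₁) ht} {c₂ : Vec (Vec (Fin k) w₂) ht} →
           rule G X ≡ hcat Y Z →
           Derives2 G Y (mk2 ht w₁ c₁) → Derives2 G Z (mk2 ht w₂ c₂) →
           Derives2 G X (mk2 ht (w₁ + w₂) (zipWith V._++_ c₁ c₂))
  d-vcat : ∀ {X Y Z h₁ h₂ wd} {c₁ : Vec (Vec (Fin k) wd) h₁} {c₂ : Vec (Vec (Fin k) wd) h₂} →
           rule G X ≡ vcat Y Z →
           Derives2 G Y (mk2 h₁ wd c₁) → Derives2 G Z (mk2 h₂ wd c₂) →
           Derives2 G X (mk2 (h₁ + h₂) wd (c₁ V.++ c₂))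

data Rule1 (k n : ℕ) : Set where
  char : Fin k → Rule1 k n
  cat  : Fin n → Fin n → Rule1 k n

data Occurs1 {k n : ℕ} (rule : Fin n → Rule1 k n) : Fin n → Fin n → Set where
  cat-l : ∀ {X Y Z} → rule X ≡ cat Y Z → Occurs1 rule Y X
  cat-r : ∀ {X Y Z} → rule X ≡ cat Y Z → Occurs1 rule Z X

record SLP1 (k : ℕ) : Set where
  field
    n       : ℕ
    start   : Fin n
    rule    : Fin n → Rule1 k n
    acyclic : WellFounded (Occurs1 rule)

rsize1 : ∀ {k n} → Rule1 k n → ℕ
rsize1 (char _) = 1
rsize1 (cat _ _) = 2

size1 : ∀ {k} → SLP1 k → ℕ
size1 H = sumFin (λ X → rsize1 (SLP1.rule H X))

data Derives1 {k : ℕ} (H : SLP1 k) : Fin (SLP1.n H) → List (Fin k) → Set where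
  d-char : ∀ {X a} → SLP1.rule H X ≡ char a → Derives1 H X (a ∷ [])
  d-cat  : ∀ {X Y Z u v} → SLP1.rule H X ≡ cat Y Z →
           Derives1 H Y u → Derives1 H Z v → Derives1 H X (u ++ v)

SLP1Derives : ∀ {k} → SLP1 k → List (Fin k) → Set
SLP1Derives H s = Derives1 H (SLP1.start H) s

SLP2Derives : ∀ {k} → SLP2 k → Str2 (Fin k) → Set
SLP2Derives G S = Derives2 G (start G) S

{-# OPTIONS --safe #-}
-- Read the top row off along the grammar: a horizontal concatenation contributes the
-- concatenation of the top rows of its parts, a vertical one only the top row of its upper
-- part (the other three sides are symmetric). On the same nonterminals this is a 1D grammar
-- with unit productions X → Y, which are eliminated by letting X inherit the resolved rule
-- of Y. No rule grows: a resolved rule has size at most 2 and only replaces a concatenation.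
module Submission where

open import Level using (0ℓ)
open import Data.Nat using (ℕ; zero; suc; _+_; _≤_; _<_; z≤n; s≤s; z<s)
open import Data.Nat.Properties using (≤-refl; ≤-reflexive; <-≤-trans; m≤m+n; +-mono-≤)
open import Data.Fin using (Fin)
import Data.Fin as Fin
open import Data.List as List using (List; _++_)
open import Data.Vec as Vec using (Vec; []; _∷_; head; last; toList; zipWith)
open import Data.Vec.Properties using (toList-++; map-++)
open import Data.Product using (Σ; _×_; _,_)
open import Induction.WellFounded
  using (WellFounded; Acc; acc; module All; module FixPoint; module Subrelation)
open import Relation.Binary.Construct.Closure.Transitive as Transitive
  using (TransClosure; [_]; _∷ʳ_)
open import Relation.Binary.PropositionalEquality using (_≡_; refl; sym; trans; cong; cong₂; subst)
open import Defs

sumFin-mono : ∀ {n} {f g : Fin n → ℕ} → (∀ i → f i ≤ g i) → sumFin f ≤ sumFin g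
sumFin-mono {zero} f≤g = z≤n
sumFin-mono {suc n} f≤g = +-mono-≤ (f≤g Fin.zero) (sumFin-mono (λ i → f≤g (Fin.suc i)))

rsize1≤2 : ∀ {k n} (r : Rule1 k n) → rsize1 r ≤ 2
rsize1≤2 (char _)  = s≤s z≤n
rsize1≤2 (cat _ _) = ≤-refl

data _∈¹_ {k n : ℕ} : Fin n → Rule1 k n → Set where
  ∈-catˡ : ∀ {Y Z} → Y ∈¹ cat Y Z
  ∈-catʳ : ∀ {Y Z} → Z ∈¹ cat Y Z

occurs⇒∈ : ∀ {k n} {rule : Fin n → Rule1 k n} {X Y} → Occurs1 rule Y X → Y ∈¹ rule X
occurs⇒∈ (cat-l e) = subst (_ ∈¹_) (sym e) ∈-catˡ
occurs⇒∈ (cat-r e) = subst (_ ∈¹_) (sym e) ∈-catʳ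

Derives1-resp-rule : ∀ {k} {H : SLP1 k} {X Y w} →
  SLP1.rule H X ≡ SLP1.rule H Y → Derives1 H Y w → Derives1 H X w
Derives1-resp-rule e (d-char e′)      = d-char (trans e e′)
Derives1-resp-rule e (d-cat e′ d₁ d₂) = d-cat (trans e e′) d₁ d₂

data Ruleᵘ (k n : ℕ) : Set where
  char : Fin k → Ruleᵘ k n
  cat  : Fin n → Fin n → Ruleᵘ k n
  unit : Fin n → Ruleᵘ k n

data _∈ᵘ_ {k n : ℕ} : Fin n → Ruleᵘ k n → Set where
  ∈-catˡ : ∀ {Y Z} → Y ∈ᵘ cat Y Z
  ∈-catʳ : ∀ {Y Z} → Z ∈ᵘ cat Y Z
  ∈-unit : ∀ {Y} → Y ∈ᵘ unit Y

module UnitElimination {k n : ℕ} (ruleᵘ : Fin n → Ruleᵘ k n)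
                       (acyclic : WellFounded (λ Y X → Y ∈ᵘ ruleᵘ X)) where

  _◁_ : Fin n → Fin n → Set
  Y ◁ X = Y ∈ᵘ ruleᵘ X

  resolveStep : (r : Ruleᵘ k n) → (∀ {Y} → Y ∈ᵘ r → Rule1 k n) → Rule1 k n
  resolveStep (char a)  _   = char a
  resolveStep (cat Y Z) _   = cat Y Z
  resolveStep (unit Y)  rec = rec ∈-unit

  resolveStep-ext : ∀ r {f g : ∀ {Y} → Y ∈ᵘ r → Rule1 k n} →
    (∀ {Y} (p : Y ∈ᵘ r) → f p ≡ g p) → resolveStep r f ≡ resolveStep r g
  resolveStep-ext (char _)  f≡g = refl
  resolveStep-ext (cat _ _) f≡g = refl
  resolveStep-ext (unit _)  f≡g = f≡g ∈-unit

  resolve : Fin n → Rule1 k n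
  resolve = All.wfRec acyclic 0ℓ _ (λ X → resolveStep (ruleᵘ X))

  resolve-unfold : ∀ {X r} → ruleᵘ X ≡ r → resolve X ≡ resolveStep r (λ {Y} _ → resolve Y)
  resolve-unfold refl =
    FixPoint.unfold-wfRec acyclic _ (λ X → resolveStep (ruleᵘ X))
                          (λ X → resolveStep-ext (ruleᵘ X))

  resolve-∈ : ∀ {X Y r} → Acc _◁_ X → ruleᵘ X ≡ r →
    Y ∈¹ resolveStep r (λ {Z} _ → resolve Z) → TransClosure _◁_ Y X
  resolve-∈ {r = cat _ _} _        e ∈-catˡ = [ subst (_ ∈ᵘ_) (sym e) ∈-catˡ ]
  resolve-∈ {r = cat _ _} _        e ∈-catʳ = [ subst (_ ∈ᵘ_) (sym e) ∈-catʳ ]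
  resolve-∈ {r = unit Z}  (acc rs) e p      =
    resolve-∈ (rs Z◁X) refl (subst (_ ∈¹_) (resolve-unfold refl) p) ∷ʳ Z◁X
    where
      Z◁X : Z ◁ _
      Z◁X = subst (Z ∈ᵘ_) (sym e) ∈-unit

  resolve-acyclic : WellFounded (Occurs1 resolve)
  resolve-acyclic = Subrelation.wellFounded resolve-occurs (Transitive.wellFounded _◁_ acyclic)
    where
      resolve-occurs : ∀ {Y X} → Occurs1 resolve Y X → TransClosure _◁_ Y X
      resolve-occurs {X = X} o =
        resolve-∈ (acyclic X) refl (subst (_ ∈¹_) (resolve-unfold refl) (occurs⇒∈ o))

last-++ : ∀ {A : Set} {m n} (xs : Vec A (suc m)) (ys : Vec A (suc n)) →
  last (xs Vec.++ ys) ≡ last ys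
last-++ (x ∷ [])          (y ∷ ys) = refl
last-++ (x ∷ xs@(_ ∷ _))  ys       = last-++ xs ys

last-zipWith : ∀ {A B C : Set} {n} (f : A → B → C) (xs : Vec A (suc n)) (ys : Vec B (suc n)) →
  last (zipWith f xs ys) ≡ f (last xs) (last ys)
last-zipWith f (x ∷ [])           (y ∷ [])           = refl
last-zipWith f (x ∷ xs@(_ ∷ _))   (y ∷ ys@(_ ∷ _))   = last-zipWith f xs ys

map-head-zipWith-++ : ∀ {A : Set} {h m n} (xss : Vec (Vec A (suc m)) h) (yss : Vec (Vec A n) h) →
  Vec.map head (zipWith Vec._++_ xss yss) ≡ Vec.map head xss
map-head-zipWith-++ []                []         = refl
map-head-zipWith-++ ((x ∷ _) ∷ xss)   (_ ∷ yss)  = cong (x ∷_) (map-head-zipWith-++ xss yss)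

map-last-zipWith-++ : ∀ {A : Set} {h m n}
  (xss : Vec (Vec A (suc m)) h) (yss : Vec (Vec A (suc n)) h) →
  Vec.map last (zipWith Vec._++_ xss yss) ≡ Vec.map last yss
map-last-zipWith-++ []         []         = refl
map-last-zipWith-++ (xs ∷ xss) (ys ∷ yss) =
  cong₂ _∷_ (last-++ xs ys) (map-last-zipWith-++ xss yss)

zipWith-[]-++ : ∀ {A : Set} {h n} (xss : Vec (Vec A 0) h) (yss : Vec (Vec A n) h) →
  zipWith Vec._++_ xss yss ≡ yss
zipWith-[]-++ []          []         = refl
zipWith-[]-++ ([] ∷ xss)  (ys ∷ yss) = cong (ys ∷_) (zipWith-[]-++ xss yss)

module _ {A : Set} where

  topRow-hcat : ∀ {h w₁ w₂} (c₁ : Vec (Vec A w₁) h) (c₂ : Vec (Vec A w₂) h) →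
    topRow (mk2 h (w₁ + w₂) (zipWith Vec._++_ c₁ c₂)) ≡ topRow (mk2 h w₁ c₁) ++ topRow (mk2 h w₂ c₂)
  topRow-hcat []       []       = refl
  topRow-hcat (x ∷ _)  (y ∷ _)  = toList-++ x y

  topRow-vcat : ∀ {h₁ h₂ w} (c₁ : Vec (Vec A w) h₁) (c₂ : Vec (Vec A w) h₂) → 0 < h₁ →
    topRow (mk2 (h₁ + h₂) w (c₁ Vec.++ c₂)) ≡ topRow (mk2 h₁ w c₁)
  topRow-vcat (_ ∷ _) _ _ = refl

  bottomRow-hcat : ∀ {h w₁ w₂} (c₁ : Vec (Vec A w₁) h) (c₂ : Vec (Vec A w₂) h) →
    bottomRow (mk2 h (w₁ + w₂) (zipWith Vec._++_ c₁ c₂))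
      ≡ bottomRow (mk2 h w₁ c₁) ++ bottomRow (mk2 h w₂ c₂)
  bottomRow-hcat []          []          = refl
  bottomRow-hcat c₁@(_ ∷ _)  c₂@(_ ∷ _)  =
    trans (cong toList (last-zipWith Vec._++_ c₁ c₂)) (toList-++ (last c₁) (last c₂))

  bottomRow-vcat : ∀ {h₁ h₂ w} (c₁ : Vec (Vec A w) h₁) (c₂ : Vec (Vec A w) h₂) → 0 < h₂ →
    bottomRow (mk2 (h₁ + h₂) w (c₁ Vec.++ c₂)) ≡ bottomRow (mk2 h₂ w c₂)
  bottomRow-vcat []          c₂          _ = refl
  bottomRow-vcat c₁@(_ ∷ _)  c₂@(_ ∷ _)  _ = cong toList (last-++ c₁ c₂)

  leftCol-hcat : ∀ {h w₁ w₂} (c₁ : Vec (Vec A w₁) h) (c₂ : Vec (Vec A w₂) h) → 0 < w₁ →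
    leftCol (mk2 h (w₁ + w₂) (zipWith Vec._++_ c₁ c₂)) ≡ leftCol (mk2 h w₁ c₁)
  leftCol-hcat c₁ c₂ z<s = cong toList (map-head-zipWith-++ c₁ c₂)

  leftCol-vcat : ∀ {h₁ h₂ w} (c₁ : Vec (Vec A w) h₁) (c₂ : Vec (Vec A w) h₂) →
    leftCol (mk2 (h₁ + h₂) w (c₁ Vec.++ c₂)) ≡ leftCol (mk2 h₁ w c₁) ++ leftCol (mk2 h₂ w c₂)
  leftCol-vcat {w = zero}  c₁ c₂ = refl
  leftCol-vcat {w = suc _}  c₁ c₂ =
    trans (cong toList (map-++ head c₁ c₂)) (toList-++ (Vec.map head c₁) (Vec.map head c₂))

  rightCol-hcat : ∀ {h w₁ w₂} (c₁ : Vec (Vec A w₁) h) (c₂ : Vec (Vec A w₂) h) → 0 < w₂ →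
    rightCol (mk2 h (w₁ + w₂) (zipWith Vec._++_ c₁ c₂)) ≡ rightCol (mk2 h w₂ c₂)
  -- last needs a length of the form suc _, which w₁ + w₂ only has once w₁ is split
  rightCol-hcat {w₁ = zero}  c₁ c₂ z<s = cong (λ c → rightCol (mk2 _ _ c)) (zipWith-[]-++ c₁ c₂)
  rightCol-hcat {w₁ = suc _}  c₁ c₂ z<s = cong toList (map-last-zipWith-++ c₁ c₂)

  rightCol-vcat : ∀ {h₁ h₂ w} (c₁ : Vec (Vec A w) h₁) (c₂ : Vec (Vec A w) h₂) →
    rightCol (mk2 (h₁ + h₂) w (c₁ Vec.++ c₂))
      ≡ rightCol (mk2 h₁ w c₁) ++ rightCol (mk2 h₂ w c₂)
  rightCol-vcat {w = zero}  c₁ c₂ = refl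
  rightCol-vcat {w = suc _}  c₁ c₂ =
    trans (cong toList (map-++ last c₁ c₂)) (toList-++ (Vec.map last c₁) (Vec.map last c₂))

data Boundary : Set where
  top bottom left right : Boundary

edge : ∀ {A : Set} → Boundary → Str2 A → List A
edge top    = topRow
edge bottom = bottomRow
edge left   = leftCol
edge right  = rightCol

edge-singleton : ∀ {A : Set} β (a : A) → edge β (mk2 1 1 ((a ∷ []) ∷ [])) ≡ a List.∷ List.[]
edge-singleton top    _ = refl
edge-singleton bottom _ = refl
edge-singleton left   _ = refl
edge-singleton right  _ = refl

project : ∀ {k n} → Boundary → Rule2 k n → Ruleᵘ k n
project _      (char a)   = char a
project top    (hcat Y Z) = cat Y Z
project top    (vcat Y Z) = unit Y
project bottom (hcat Y Z) = cat Y Z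
project bottom (vcat Y Z) = unit Z
project left   (hcat Y Z) = unit Y
project left   (vcat Y Z) = cat Y Z
project right  (hcat Y Z) = unit Z
project right  (vcat Y Z) = cat Y Z

project-occurs : ∀ {k n} {rule : Fin n → Rule2 k n} β {X Y r} →
  rule X ≡ r → Y ∈ᵘ project β r → Occurs2 rule Y X
project-occurs top    {r = hcat _ _} e ∈-catˡ = hcat-l e
project-occurs top    {r = hcat _ _} e ∈-catʳ = hcat-r e
project-occurs top    {r = vcat _ _} e ∈-unit = vcat-l e
project-occurs bottom {r = hcat _ _} e ∈-catˡ = hcat-l e
project-occurs bottom {r = hcat _ _} e ∈-catʳ = hcat-r e
project-occurs bottom {r = vcat _ _} e ∈-unit = vcat-r e
project-occurs left   {r = hcat _ _} e ∈-unit = hcat-l e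
project-occurs left   {r = vcat _ _} e ∈-catˡ = vcat-l e
project-occurs left   {r = vcat _ _} e ∈-catʳ = vcat-r e
project-occurs right  {r = hcat _ _} e ∈-unit = hcat-r e
project-occurs right  {r = vcat _ _} e ∈-catˡ = vcat-l e
project-occurs right  {r = vcat _ _} e ∈-catʳ = vcat-r e

module _ {k : ℕ} (G : SLP2 k) where

  height-positive : ∀ {X S} → Derives2 G X S → 0 < h S
  height-positive (d-char _)      = z<s
  height-positive (d-hcat _ d _)  = height-positive d
  height-positive (d-vcat _ d _)  = <-≤-trans (height-positive d) (m≤m+n _ _)

  width-positive : ∀ {X S} → Derives2 G X S → 0 < w S
  width-positive (d-char _)      = z<s
  width-positive (d-hcat _ d _)  = <-≤-trans (width-positive d) (m≤m+n _ _)
  width-positive (d-vcat _ d _)  = width-positive d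

  private
    module Projected (β : Boundary) =
      UnitElimination (λ X → project β (rule G X))
                      (Subrelation.wellFounded (project-occurs β refl) (acyclic G))
    open Projected using (resolve; resolve-unfold; resolve-acyclic)

  boundarySLP : Boundary → SLP1 k
  boundarySLP β = record
    { n = n G ; start = start G ; rule = resolve β ; acyclic = resolve-acyclic β }

  boundarySLP-size : ∀ β → size1 (boundarySLP β) ≤ size2 G
  boundarySLP-size β = sumFin-mono resolve-size
    where
      resolve-size : ∀ X → rsize1 (resolve β X) ≤ rsize2 (rule G X)
      resolve-size X = bound (rule G X) refl
        where
          bound : ∀ r → rule G X ≡ r → rsize1 (resolve β X) ≤ rsize2 r
          bound (char a)   e = ≤-reflexive (cong rsize1 (resolve-unfold β (cong (project β) e)))
          bound (hcat _ _) _ = rsize1≤2 _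
          bound (vcat _ _) _ = rsize1≤2 _

  derives-char : ∀ β {X a w} → project β (rule G X) ≡ char a → w ≡ a List.∷ List.[] →
    Derives1 (boundarySLP β) X w
  derives-char β p refl = d-char (resolve-unfold β p)

  derives-cat : ∀ β {X Y Z u v w} → project β (rule G X) ≡ cat Y Z → w ≡ u ++ v →
    Derives1 (boundarySLP β) Y u → Derives1 (boundarySLP β) Z v → Derives1 (boundarySLP β) X w
  derives-cat β p refl = d-cat (resolve-unfold β p)

  derives-unit : ∀ β {X Y u w} → project β (rule G X) ≡ unit Y → w ≡ u →
    Derives1 (boundarySLP β) Y u → Derives1 (boundarySLP β) X w
  derives-unit β p refl = Derives1-resp-rule (resolve-unfold β p)

  boundarySLP-derives : ∀ β {X S} → Derives2 G X S → Derives1 (boundarySLP β) X (edge β S)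
  boundarySLP-derives β (d-char e) = derives-char β (cong (project β) e) (edge-singleton β _)
  boundarySLP-derives top (d-hcat {c₁ = c₁} {c₂ = c₂} e d₁ d₂) =
    derives-cat top (cong (project top) e) (topRow-hcat c₁ c₂)
      (boundarySLP-derives top d₁) (boundarySLP-derives top d₂)
  boundarySLP-derives top (d-vcat {c₁ = c₁} {c₂ = c₂} e d₁ d₂) =
    derives-unit top (cong (project top) e) (topRow-vcat c₁ c₂ (height-positive d₁))
      (boundarySLP-derives top d₁)
  boundarySLP-derives bottom (d-hcat {c₁ = c₁} {c₂ = c₂} e d₁ d₂) =
    derives-cat bottom (cong (project bottom) e) (bottomRow-hcat c₁ c₂)
      (boundarySLP-derives bottom d₁) (boundarySLP-derives bottom d₂)
  boundarySLP-derives bottom (d-vcat {c₁ = c₁} {c₂ = c₂} e d₁ d₂) =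
    derives-unit bottom (cong (project bottom) e) (bottomRow-vcat c₁ c₂ (height-positive d₂))
      (boundarySLP-derives bottom d₂)
  boundarySLP-derives left (d-hcat {c₁ = c₁} {c₂ = c₂} e d₁ d₂) =
    derives-unit left (cong (project left) e) (leftCol-hcat c₁ c₂ (width-positive d₁))
      (boundarySLP-derives left d₁)
  boundarySLP-derives left (d-vcat {c₁ = c₁} {c₂ = c₂} e d₁ d₂) =
    derives-cat left (cong (project left) e) (leftCol-vcat c₁ c₂)
      (boundarySLP-derives left d₁) (boundarySLP-derives left d₂)
  boundarySLP-derives right (d-hcat {c₁ = c₁} {c₂ = c₂} e d₁ d₂) =
    derives-unit right (cong (project right) e) (rightCol-hcat c₁ c₂ (width-positive d₂))
      (boundarySLP-derives right d₂)
  boundarySLP-derives right (d-vcat {c₁ = c₁} {c₂ = c₂} e d₁ d₂) =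
    derives-cat right (cong (project right) e) (rightCol-vcat c₁ c₂)
      (boundarySLP-derives right d₁) (boundarySLP-derives right d₂)

lemma4p5 : ∀ {k : ℕ} (G : SLP2 k) (S : Str2 (Fin k)) → SLP2Derives G S →
    (Σ (SLP1 k) λ H → SLP1Derives H (topRow S) × size1 H ≤ size2 G)
    × (Σ (SLP1 k) λ H → SLP1Derives H (bottomRow S) × size1 H ≤ size2 G)
    × (Σ (SLP1 k) λ H → SLP1Derives H (leftCol S) × size1 H ≤ size2 G)
    × (Σ (SLP1 k) λ H → SLP1Derives H (rightCol S) × size1 H ≤ size2 G)
lemma4p5 {k} G S d = boundary top , boundary bottom , boundary left , boundary right
  where
    boundary : ∀ β → Σ (SLP1 k) λ H → SLP1Derives H (edge β S) × size1 H ≤ size2 G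
    boundary β = boundarySLP G β , boundarySLP-derives G β d , boundarySLP-size G β
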